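{- Let $T$ be a tree with at least two vertices. Then the set of leaves (vertices of degree $1$) of $T$ is a fault tolerant zero forcing set of $T$. Hence $\mathrm{Z}_t(T)\le \ell(T)$, where $\ell(T)$ is the number of leaves of $T$.
   Context: Zero forcing: given a set $B\subseteq V(G)$ of initially blue vertices (all others white), the color change rule allows a blue vertex $b$ to turn a white vertex $w$ blue if $w$ is the unique white neighbor of $b$. $B$ is a zero forcing set if repeated application of this rule eventually turns all of $V(G)$ blue. A set $B\subseteq V(G)$ with $|B|=m\ge 1$ is a fault tolerant zero forcing set if every subset $F\subseteq B$ with $|F|=m-1$ is a zero forcing set of $G$. $\mathrm{Z}_t(G)$ is the minimum cardinality of a fault tolerant zero forcing set of $G$. -}

module Defs where

open import Data.Nat using (ℕ; zero; suc; _≤_; _∸_; _≟_)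
open import Data.Bool using (Bool; true; false)
open import Data.Fin using (Fin)
open import Data.Fin.Subset using (Subset; _∈_; _⊆_; ∣_∣)
open import Data.Vec using (tabulate)
open import Data.List using (List; []; _∷_; _++_; [_]; length)
open import Data.List.Relation.Unary.Linked using (Linked)
open import Data.List.Relation.Unary.Unique.Propositional using (Unique)
open import Data.Product using (Σ; _×_; ∃; ∃-syntax)
open import Relation.Binary.PropositionalEquality using (_≡_; _≢_)
open import Relation.Nullary using (¬_)
open import Relation.Nullary.Decidable using (⌊_⌋)

record Graph (n : ℕ) : Set where
  field
    adj   : Fin n → Fin n → Bool
    sym   : ∀ u v → adj u v ≡ adj v u
    irrefl : ∀ u → adj u u ≡ false

open Graph public

module _ {n : ℕ} (G : Graph n) where

  Adj : Fin n → Fin n → Set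
  Adj u v = adj G u v ≡ true

  nbhd : Fin n → Subset n
  nbhd u = tabulate (adj G u)

  degree : Fin n → ℕ
  degree u = ∣ nbhd u ∣

  data Walk : Fin n → Fin n → Set where
    here : ∀ {u} → Walk u u
    step : ∀ {u v w} → Adj u v → Walk v w → Walk u w

  Connected : Set
  Connected = ∀ u v → Walk u v

  -- a cycle: distinct vertices x, z₁, …, zₖ, y (k ≥ 1) consecutively adjacent,
  -- with y adjacent to x (so at least 3 vertices)
  IsCycle : Fin n → List (Fin n) → Fin n → Set
  IsCycle x zs y =
    (1 ≤ length zs) × Linked Adj (x ∷ zs ++ [ y ]) × Unique (x ∷ zs ++ [ y ]) × Adj y x

  Acyclic : Set
  Acyclic = ∀ x zs y → ¬ IsCycle x zs y

  IsTree : Set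
  IsTree = Connected × Acyclic

  leaves : Subset n
  leaves = tabulate (λ u → ⌊ degree u ≟ 1 ⌋)

  numLeaves : ℕ
  numLeaves = ∣ leaves ∣

  -- the set of vertices that end up blue starting from B (closure under the
  -- colour change rule: a blue vertex b forces w if w is b's unique white neighbour)
  data Blue (B : Subset n) : Fin n → Set where
    initial : ∀ {v} → v ∈ B → Blue B v
    force   : ∀ {b w} → Blue B b → Adj b w →
              (∀ x → Adj b x → x ≢ w → Blue B x) → Blue B w

  IsZeroForcingSet : Subset n → Set
  IsZeroForcingSet B = ∀ v → Blue B v

  IsFaultTolerantZFS : Subset n → Set
  IsFaultTolerantZFS B =
    (1 ≤ ∣ B ∣) × (∀ F → F ⊆ B → ∣ F ∣ ≡ ∣ B ∣ ∸ 1 → IsZeroForcingSet F)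

  IsZt : ℕ → Set
  IsZt k = (∃[ B ] (IsFaultTolerantZFS B × ∣ B ∣ ≡ k))
         × (∀ B → IsFaultTolerantZFS B → k ≤ ∣ B ∣)

{-# OPTIONS --safe #-}
module Submission where

open import Defs
open import Data.Nat using (ℕ; _≤_)
open import Data.Product using (_×_)

open import Data.Bool as Bool using (Bool; true)
open import Data.Empty using (⊥-elim)
open import Data.Fin as Fin using (Fin; zero; suc; punchIn)
open import Data.Fin.Properties using (any?; pigeonhole; punchInᵢ≢i; _≟_)
open import Data.Fin.Subset using (Subset; _∈_; _∉_; _⊆_; _⊂_; _∪_; ⁅_⁆; _-_; ∣_∣; Nonempty)
open import Data.Fin.Subset.Properties
  using (_∈?_; ⊆-antisym; x∈⁅x⁆; x∈⁅y⁆⇒x≡y; ∣⁅x⁆∣≡1; x∈p∪q⁺; x∈p∪q⁻; x∈p∧x≢y⇒x∈p-y; p⊂q⇒∣p∣<∣q∣; x∈p⇒∣p-x∣<∣p∣)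
open import Data.List using (List; []; _∷_; _++_; [_]; length; lookup)
open import Data.List.Properties using (++-assoc)
open import Data.List.Membership.Propositional using () renaming (_∈_ to _∈ₗ_; _∉_ to _∉ₗ_)
open import Data.List.Membership.Propositional.Properties using (∈-∃++; ∈-lookup)
import Data.List.Relation.Unary.All as All
open import Data.List.Relation.Unary.All.Properties using (++⁻ˡ; ¬Any⇒All¬)
open import Data.List.Relation.Unary.AllPairs as AllPairs using (AllPairs)
open import Data.List.Relation.Unary.Any as Any using (here; there)
open import Data.List.Relation.Unary.Linked as Linked using (Linked; []; [-]; _∷_)
open import Data.List.Relation.Unary.Unique.Propositional using (Unique)
open import Data.List.Relation.Unary.Unique.Propositional.Properties using (Unique[x∷xs]⇒x∉xs)
open import Data.Nat as ℕ using (zero; suc; _<_; _∸_; _+_; z≤n; s≤s; s<s⁻¹)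
open import Data.Nat.Properties using (_≤?_; ≰⇒>; ≤⇒≯; n≮n; ≤-trans; +-suc; +-monoʳ-≤; n≤1+n; m<m+n; ∸-monoˡ-≤)
open import Data.Product using (∃; _,_; proj₂)
open import Data.Sum using (inj₁; inj₂; [_,_]′)
open import Data.Vec using (tabulate)
open import Data.Vec.Properties using (lookup∘tabulate; []=⇒lookup; lookup⇒[]=)
open import Function using (_∘_; id)
open import Relation.Binary.PropositionalEquality as ≡ using (_≡_; _≢_; refl; trans; cong; subst)
open import Relation.Nullary using (¬_; yes; no; ¬?)
open import Relation.Nullary.Decidable using (isYes≗does; dec-true; decidable-stable; _×-dec_)

-- Root T at a vertex r and let F contain every leaf except possibly r. A
-- non-root vertex v that is not a leaf has a child c; by downward induction on
-- depth (bounded by n, as root paths are simple) c and all children of c are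
-- blue, so c forces its only remaining white neighbour, its parent v. Once all
-- non-root vertices are blue, any neighbour of r forces r. Finally, a set of
-- ℓ(T) − 1 leaves misses at most one leaf, which we take as the root.

module _ {A : Set} where

  data EndsWith (r : A) : List A → Set where
    end : EndsWith r [ r ]
    _∷_ : ∀ x {xs} → EndsWith r xs → EndsWith r (x ∷ xs)

  EndsWith⇒∈ : ∀ {r xs} → EndsWith r xs → r ∈ₗ xs
  EndsWith⇒∈ end     = here refl
  EndsWith⇒∈ (_ ∷ e) = there (EndsWith⇒∈ e)

  EndsWith[x]⇒x≡r : ∀ {r x} → EndsWith r [ x ] → x ≡ r
  EndsWith[x]⇒x≡r end = refl

  EndsWith-++⁻ʳ : ∀ {r} xs {y ys} → EndsWith r (xs ++ y ∷ ys) → EndsWith r (y ∷ ys)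
  EndsWith-++⁻ʳ []           e       = e
  EndsWith-++⁻ʳ (_ ∷ [])     (_ ∷ e) = e
  EndsWith-++⁻ʳ (_ ∷ _ ∷ xs) (_ ∷ e) = EndsWith-++⁻ʳ (_ ∷ xs) e

  module _ {R : A → A → Set} where

    Linked-++⁻ˡ : ∀ xs {ys} → Linked R (xs ++ ys) → Linked R xs
    Linked-++⁻ˡ []           _        = []
    Linked-++⁻ˡ (_ ∷ [])     _        = [-]
    Linked-++⁻ˡ (_ ∷ y ∷ xs) (r ∷ rs) = r ∷ Linked-++⁻ˡ (y ∷ xs) rs

    Linked-++⁻ʳ : ∀ xs {ys} → Linked R (xs ++ ys) → Linked R ys
    Linked-++⁻ʳ []       rs = rs
    Linked-++⁻ʳ (_ ∷ xs) rs = Linked-++⁻ʳ xs (Linked.tail rs)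

    AllPairs-++⁻ˡ : ∀ xs {ys} → AllPairs R (xs ++ ys) → AllPairs R xs
    AllPairs-++⁻ˡ []       _                 = AllPairs.[]
    AllPairs-++⁻ˡ (_ ∷ xs) (p AllPairs.∷ ps) = ++⁻ˡ xs p AllPairs.∷ AllPairs-++⁻ˡ xs ps

    AllPairs-++⁻ʳ : ∀ xs {ys} → AllPairs R (xs ++ ys) → AllPairs R ys
    AllPairs-++⁻ʳ []       ps = ps
    AllPairs-++⁻ʳ (_ ∷ xs) ps = AllPairs-++⁻ʳ xs (AllPairs.tail ps)

  Unique⇒lookup-injective : ∀ {xs : List A} → Unique xs →
                            ∀ {i j} → i Fin.< j → lookup xs i ≢ lookup xs j
  Unique⇒lookup-injective (x∉xs AllPairs.∷ _) {zero}  {suc j} _   = All.lookup x∉xs (∈-lookup j)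
  Unique⇒lookup-injective (_ AllPairs.∷ xs!)  {suc i} {suc j} i<j =
    Unique⇒lookup-injective xs! (s<s⁻¹ i<j)

Unique⇒length≤ : ∀ {n} {xs : List (Fin n)} → Unique xs → length xs ≤ n
Unique⇒length≤ {n} {xs} xs! with length xs ≤? n
... | yes ≤n = ≤n
... | no ≰n with i , j , i<j , eq ← pigeonhole (≰⇒> ≰n) (lookup xs) =
  ⊥-elim (Unique⇒lookup-injective xs! i<j eq)

∈-tabulate⁺ : ∀ {n} {f : Fin n → Bool} {x} → f x ≡ true → x ∈ tabulate f
∈-tabulate⁺ {f = f} {x} fx = lookup⇒[]= x (tabulate f) (trans (lookup∘tabulate f x) fx)

∈-tabulate⁻ : ∀ {n} {f : Fin n → Bool} {x} → x ∈ tabulate f → f x ≡ true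
∈-tabulate⁻ {f = f} {x} x∈ = trans (≡.sym (lookup∘tabulate f x)) ([]=⇒lookup x∈)

x∈p⇒0<∣p∣ : ∀ {n} {p : Subset n} {x} → x ∈ p → 0 < ∣ p ∣
x∈p⇒0<∣p∣ x∈p = ≤-trans (s≤s z≤n) (x∈p⇒∣p-x∣<∣p∣ x∈p)

anotherVertex : ∀ {n} → 2 ≤ n → (r : Fin n) → ∃ λ w → w ≢ r
anotherVertex (s≤s (s≤s _)) r = punchIn r zero , punchInᵢ≢i r zero

x∈q∧x∉p∧∣p∣≡∣q∣∸1⇒q⊆p∪⁅x⁆ : ∀ {n} {p q : Subset n} {x} → p ⊆ q → ∣ p ∣ ≡ ∣ q ∣ ∸ 1 →
                             x ∈ q → x ∉ p → q ⊆ p ∪ ⁅ x ⁆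
x∈q∧x∉p∧∣p∣≡∣q∣∸1⇒q⊆p∪⁅x⁆ {p = p} {q} {x} p⊆q ∣p∣≡ x∈q x∉p {v} v∈q with v ∈? p | v ≟ x
... | yes v∈p | _        = x∈p∪q⁺ (inj₁ v∈p)
... | no _    | yes refl = x∈p∪q⁺ (inj₂ (x∈⁅x⁆ x))
... | no v∉p  | no v≢x   = ⊥-elim (n≮n ∣ p ∣ (subst (suc ∣ p ∣ ≤_) (≡.sym ∣p∣≡) (∸-monoˡ-≤ 1 2+∣p∣≤∣q∣)))
  where
  p⊂q-x : p ⊂ q - x
  p⊂q-x = (λ y∈p → x∈p∧x≢y⇒x∈p-y (p⊆q y∈p) λ { refl → x∉p y∈p })
        , v , x∈p∧x≢y⇒x∈p-y v∈q v≢x , v∉p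
  2+∣p∣≤∣q∣ : 2 + ∣ p ∣ ≤ ∣ q ∣
  2+∣p∣≤∣q∣ = ≤-trans (s≤s (p⊂q⇒∣p∣<∣q∣ p⊂q-x)) (x∈p⇒∣p-x∣<∣p∣ x∈q)

p⊆q∧∣p∣≡∣q∣∸1⇒∃q⊆p∪⁅x⁆ : ∀ {n} {p q : Subset n} → Fin n → p ⊆ q → ∣ p ∣ ≡ ∣ q ∣ ∸ 1 →
                          ∃ λ x → q ⊆ p ∪ ⁅ x ⁆
p⊆q∧∣p∣≡∣q∣∸1⇒∃q⊆p∪⁅x⁆ {p = p} {q} x₀ p⊆q ∣p∣≡ with any? (λ x → x ∈? q ×-dec ¬? (x ∈? p))
... | yes (x , x∈q , x∉p) = x , x∈q∧x∉p∧∣p∣≡∣q∣∸1⇒q⊆p∪⁅x⁆ p⊆q ∣p∣≡ x∈q x∉p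
... | no none = x₀ , λ {v} v∈q →
  x∈p∪q⁺ (inj₁ (decidable-stable (v ∈? p) λ v∉p → none (v , v∈q , v∉p)))

module _ {n} (G : Graph n) where

  Adj-sym : ∀ {u v} → Adj G u v → Adj G v u
  Adj-sym {u} {v} u~v = trans (Graph.sym G v u) u~v

  Adj-irrefl : ∀ {u v} → Adj G u v → u ≢ v
  Adj-irrefl {u} u~u refl with () ← trans (≡.sym u~u) (Graph.irrefl G u)

  degree≡1⇒∈leaves : ∀ {v} → degree G v ≡ 1 → v ∈ leaves G
  degree≡1⇒∈leaves {v} deg≡1 = ∈-tabulate⁺ (trans (isYes≗does d) (dec-true d deg≡1))
    where d = degree G v ℕ.≟ 1

  anotherNeighbour : ∀ {v u} → degree G v ≢ 1 → Adj G v u → ∃ λ c → Adj G v c × c ≢ u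
  anotherNeighbour {v} {u} deg≢1 v~u with any? (λ c → (adj G v c Bool.≟ true) ×-dec ¬? (c ≟ u))
  ... | yes found = found
  ... | no none   = ⊥-elim (deg≢1 (trans (cong ∣_∣ nbhd≡⁅u⁆) (∣⁅x⁆∣≡1 u)))
    where
    nbhd≡⁅u⁆ : nbhd G v ≡ ⁅ u ⁆
    nbhd≡⁅u⁆ = ⊆-antisym
      (λ {c} c∈ → subst (_∈ ⁅ u ⁆)
         (≡.sym (decidable-stable (c ≟ u) λ c≢u → none (c , ∈-tabulate⁻ c∈ , c≢u))) (x∈⁅x⁆ u))
      (λ {c} c∈⁅u⁆ → subst (_∈ nbhd G v) (≡.sym (x∈⁅y⁆⇒x≡y u c∈⁅u⁆)) (∈-tabulate⁺ v~u))

  Blue⇒Nonempty : ∀ {B v} → Blue G B v → Nonempty B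
  Blue⇒Nonempty (initial v∈B)  = _ , v∈B
  Blue⇒Nonempty (force b~ _ _) = Blue⇒Nonempty b~

module RootedTree {n} (T : Graph n) (connected : Connected T) (acyclic : Acyclic T) (r : Fin n) where

  RootPath : List (Fin n) → Set
  RootPath xs = Linked (Adj T) xs × Unique xs × EndsWith r xs

  RootPath[r] : RootPath [ r ]
  RootPath[r] = [-] , All.[] AllPairs.∷ AllPairs.[] , end

  RootPath⇒length≤ : ∀ {xs} → RootPath xs → length xs ≤ n
  RootPath⇒length≤ (_ , xs! , _) = Unique⇒length≤ xs!

  RootPath⇒≢r : ∀ {v u us} → RootPath (v ∷ u ∷ us) → v ≢ r
  RootPath⇒≢r (_ , xs! , (_ ∷ e)) refl = Unique[x∷xs]⇒x∉xs xs! (EndsWith⇒∈ e)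

  RootPath-++⁻ʳ : ∀ xs {y ys} → RootPath (xs ++ y ∷ ys) → RootPath (y ∷ ys)
  RootPath-++⁻ʳ xs (linked , xs! , e) =
    Linked-++⁻ʳ xs linked , AllPairs-++⁻ʳ xs xs! , EndsWith-++⁻ʳ xs e

  noChord : ∀ x z zs y {ys} → Linked (Adj T) (x ∷ z ∷ zs ++ y ∷ ys) →
            Unique (x ∷ z ∷ zs ++ y ∷ ys) → ¬ Adj T y x
  noChord x z zs y {ys} linked xs! y~x = acyclic x (z ∷ zs) y
    (s≤s z≤n , Linked-++⁻ˡ cycle (subst (Linked (Adj T)) split linked)
             , AllPairs-++⁻ˡ cycle (subst Unique split xs!) , y~x)
    where
    cycle : List (Fin n)
    cycle = x ∷ z ∷ zs ++ [ y ]
    split : x ∷ z ∷ zs ++ y ∷ ys ≡ cycle ++ ys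
    split = cong (λ l → x ∷ z ∷ l) (≡.sym (++-assoc zs [ y ] ys))

  extend : ∀ {v u us c} → RootPath (v ∷ u ∷ us) → Adj T v c → c ≢ u → RootPath (c ∷ v ∷ u ∷ us)
  extend {v} {u} {us} {c} (linked , xs! , e) v~c c≢u =
    Adj-sym T v~c ∷ linked , ¬Any⇒All¬ _ c∉ AllPairs.∷ xs! , c ∷ e
    where
    c∉ : c ∉ₗ v ∷ u ∷ us
    c∉ (here c≡v)         = Adj-irrefl T v~c (≡.sym c≡v)
    c∉ (there (here c≡u)) = c≢u c≡u
    c∉ (there (there c∈us)) with as , bs , refl ← ∈-∃++ c∈us =
      noChord v u as c linked xs! (Adj-sym T v~c)

  walk⇒RootPath : ∀ {x w xs} → Walk T x w → RootPath (x ∷ xs) → ∃ λ ws → RootPath (w ∷ ws)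
  walk⇒RootPath here p = _ , p
  walk⇒RootPath {x} {xs = xs} (step {v = y} x~y walk) p@(linked , xs! , e) with Any.any? (y ≟_) (x ∷ xs)
  ... | yes y∈ with as , bs , eq ← ∈-∃++ y∈ =
    walk⇒RootPath walk (RootPath-++⁻ʳ as (subst RootPath eq p))
  ... | no y∉ =
    walk⇒RootPath walk (Adj-sym T x~y ∷ linked , ¬Any⇒All¬ _ y∉ AllPairs.∷ xs! , y ∷ e)

  module _ {F : Subset n} (leaves⊆F∪r : leaves T ⊆ F ∪ ⁅ r ⁆) where

    ∈leaves∧≢r⇒∈F : ∀ {v} → v ∈ leaves T → v ≢ r → v ∈ F
    ∈leaves∧≢r⇒∈F v∈leaves v≢r =
      [ id , ⊥-elim ∘ v≢r ∘ x∈⁅y⁆⇒x≡y r ]′ (x∈p∪q⁻ F ⁅ r ⁆ (leaves⊆F∪r v∈leaves))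

    -- The fuel k bounds how often a root path can still be extended: it is
    -- simple, so its length never exceeds n.
    blue-below : ∀ k {v u us} → RootPath (v ∷ u ∷ us) → n < k + length (v ∷ u ∷ us) → Blue T F v
    blue-below zero    p n< = ⊥-elim (≤⇒≯ (RootPath⇒length≤ p) n<)
    blue-below (suc k) {v} {u} {us} p@(v~u ∷ _ , _) n< with degree T v ℕ.≟ 1
    ... | yes deg≡1 = initial (∈leaves∧≢r⇒∈F (degree≡1⇒∈leaves T deg≡1) (RootPath⇒≢r p))
    ... | no deg≢1 with c , v~c , c≢u ← anotherNeighbour T deg≢1 v~u =
      force (blue-below k pc n<ₖ) (Adj-sym T v~c)
            λ y c~y y≢v → blue-below k (extend pc c~y y≢v) (≤-trans n<ₖ (+-monoʳ-≤ k (n≤1+n _)))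
      where
      pc : RootPath (c ∷ v ∷ u ∷ us)
      pc = extend p v~c c≢u
      n<ₖ : n < k + length (c ∷ v ∷ u ∷ us)
      n<ₖ = subst (n <_) (≡.sym (+-suc k _)) n<

    blue-nonroot : ∀ v → v ≢ r → Blue T F v
    blue-nonroot v v≢r with walk⇒RootPath (connected r v) RootPath[r]
    ... | []     , (_ , _ , e) = ⊥-elim (v≢r (EndsWith[x]⇒x≡r e))
    ... | u ∷ us , p           = blue-below n p (m<m+n n (s≤s z≤n))

    blue-root : 2 ≤ n → Blue T F r
    blue-root 2≤n with w , w≢r ← anotherVertex 2≤n r with connected r w
    ... | here       = ⊥-elim (w≢r refl)
    ... | step r~a _ = force (blue-nonroot _ (Adj-irrefl T r~a ∘ ≡.sym)) (Adj-sym T r~a)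
                             λ x _ x≢r → blue-nonroot x x≢r

    isZeroForcingSet : 2 ≤ n → IsZeroForcingSet T F
    isZeroForcingSet 2≤n v with v ≟ r
    ... | yes refl = blue-root 2≤n
    ... | no v≢r   = blue-nonroot v v≢r

theorem3p10 : ∀ {n} (T : Graph n) → 2 ≤ n → IsTree T →
    IsFaultTolerantZFS T (leaves T) × (∀ k → IsZt T k → k ≤ numLeaves T)
theorem3p10 T 2≤n@(s≤s (s≤s _)) (connected , acyclic) =
  leavesFaultTolerant , λ k isZt → proj₂ isZt (leaves T) leavesFaultTolerant
  where
  open RootedTree T connected acyclic using (isZeroForcingSet)
  leavesZFS : IsZeroForcingSet T (leaves T)
  leavesZFS = isZeroForcingSet zero (x∈p∪q⁺ ∘ inj₁) 2≤n
  leavesFaultTolerant : IsFaultTolerantZFS T (leaves T)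
  leavesFaultTolerant =
      x∈p⇒0<∣p∣ (proj₂ (Blue⇒Nonempty T (leavesZFS zero)))
    , λ F F⊆leaves ∣F∣≡ → let r , leaves⊆F∪r = p⊆q∧∣p∣≡∣q∣∸1⇒∃q⊆p∪⁅x⁆ zero F⊆leaves ∣F∣≡
                          in isZeroForcingSet r leaves⊆F∪r 2≤n
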